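{- Let $m$ be a positive integer, let $t$ be an integer with $0\leq t\leq m$, and let $s_1,\dots,s_t$ be positive integers with $s_t\mid\cdots\mid s_1$. Let $A_m(\bm{s})$ be the $m\times\frac{m^2-m+2t}{2}$ integer matrix whose columns are $s_1\bm{e}_1,\dots,s_t\bm{e}_t$ together with $\bm{e}_i-\bm{e}_j$ for $1\leq i<j\leq m$, where $\bm{e}_i\in\mathbb{Z}^m$ is the $i$th standard unit column vector. Let $\rho:=s_1$ if $t\geq 1$ and $\rho:=1$ if $t=0$. Let $k$ be a positive integer with $k\mid\rho$, and for $1\leq i\leq t$ let $d_i:=\gcd(k,s_i)$. Then for every $q\in k+\rho\mathbb{Z}_{\geq 0}$, the number of $\bm{x}=(x_1,\dots,x_m)\in\mathbb{Z}_q^m$ such that every entry of $\bm{x}[A_m(\bm{s})]_q$ is nonzero (i.e. $s_ix_i\neq 0$ in $\mathbb{Z}_q$ for $1\leq i\leq t$ and $x_i-x_j\neq 0$ for $1\leq i<j\leq m$) equals $$\chi^k_{A_m(\bm{s})}(q)=\prod_{i=1}^{t}(q-d_i-i+1)\prod_{i=t+1}^{m}(q-i+1).$$ In other words, the $k$-constituent of the characteristic quasi-polynomial of $A_m(\bm{s})$ with respect to the period $\rho$ is the polynomial above.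
   Context: $\mathbb{Z}_q=\mathbb{Z}/q\mathbb{Z}$ and $[S]_q$ denotes entrywise reduction mod $q$ of an integer matrix $S$. For an integer matrix $S$ with $m$ rows and $n$ columns, the characteristic quasi-polynomial is $\chi_S^{quasi}(q)=\#\{\bm{x}\in\mathbb{Z}_q^m\mid \bm{x}[S]_q\in(\mathbb{Z}_q\setminus\{0\})^n\}$; it is a quasi-polynomial with period $\rho$ (here the lcm period), and its $k$-constituent $\chi^k_S$ is the polynomial agreeing with it on all $q\equiv k \pmod{\rho}$. Empty products equal $1$. -}

module Defs where

open import Data.Nat as ℕ using (ℕ; zero; suc)
open import Data.Nat.GCD using (gcd)
open import Data.Integer as ℤ using (ℤ; +_; _-_)
open import Data.Integer.DivMod using (_%ℕ_)
open import Data.Fin as Fin using (Fin; toℕ; inject≤)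
open import Data.Vec as Vec using (Vec; []; _∷_; tabulate; zipWith)
open import Data.List as List using (List; [_]; concatMap; map; filter; length; allFin; _++_)
open import Data.Bool using (Bool; true; false; if_then_else_)
import Data.Bool as B
open import Relation.Nullary.Decidable using (does)
open import Relation.Nullary using (¬_)
open import Data.Nat.Properties using (_≟_)
import Data.Fin.Properties as FinP

-- An integer matrix with m rows, given as the list of its columns
-- (each column is a vector in ℤ^m); the number of columns is its length.
IntMatrix : ℕ → Set
IntMatrix m = List (Vec ℤ m)

allVecs : (m q : ℕ) → List (Vec (Fin q) m)
allVecs zero    q = [ [] ]
allVecs (suc m) q = concatMap (λ a → map (a ∷_) (allVecs m q)) (allFin q)

dot : ∀ {m q} → Vec (Fin q) m → Vec ℤ m → ℤ
dot x c = Vec.foldr _ ℤ._+_ (+ 0) (zipWith (λ a b → (+ toℕ a) ℤ.* b) x c)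

-- is an integer zero modulo q  (q = 0 never occurs below: ℤ_0 has no vectors counted)
isZeroMod : ℤ → ℕ → Bool
isZeroMod z zero    = does (ℤ.∣ z ∣ ≟ 0)
isZeroMod z (suc q) = does ((z %ℕ suc q) ≟ 0)

allNonzero : ∀ {m q} → IntMatrix m → Vec (Fin q) m → Bool
allNonzero List.[]       x = true
allNonzero {q = q} (c List.∷ cs) x = if isZeroMod (dot x c) q then false else allNonzero cs x

χquasi : ∀ {m} → IntMatrix m → ℕ → ℕ
χquasi {m} S q = length (filter (λ x → allNonzero S x B.≟ true) (allVecs m q))

unitVec : ∀ {m} → Fin m → Vec ℤ m
unitVec i = tabulate (λ j → if does (i Fin.≟ j) then + 1 else + 0)

A : (m t : ℕ) → t ℕ.≤ m → (Fin t → ℕ) → IntMatrix m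
A m t t≤m s =
  map (λ i → Vec.map ((+ s i) ℤ.*_) (unitVec (inject≤ i t≤m))) (allFin t)
  ++ concatMap (λ i → concatMap (λ j → if does (toℕ i ℕ.<? toℕ j)
                                        then [ zipWith _-_ (unitVec i) (unitVec j) ]
                                        else List.[])
                                (allFin m))
               (allFin m)

ρ : (t : ℕ) → (Fin t → ℕ) → ℕ
ρ zero    s = 1
ρ (suc t) s = s Fin.zero

-- ∏_{i=1}^{t} (q - d_i - i + 1), with d_i = gcd(k, s_i); index i = toℕ j + 1
prodD : (q k t : ℕ) → (Fin t → ℕ) → ℤ
prodD q k t s = List.foldr ℤ._*_ (+ 1)
  (map (λ j → (+ q) - (+ gcd k (s j)) - (+ toℕ j)) (allFin t))

-- ∏_{i=t+1}^{m} (q - i + 1) = ∏_{j=t}^{m-1} (q - j)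
prodRest : (q t m : ℕ) → ℤ
prodRest q t m = List.foldr ℤ._*_ (+ 1)
  (map (λ j → (+ q) - (+ j)) (List.filter (λ j → t ℕ.≤? j) (List.upTo m)))

{-# OPTIONS --safe #-}
module Submission where

-- Write x = (x_0, …, x_{m-1}) and count coordinate by coordinate.  Entry e must avoid the
-- s_e-torsion of ℤ_q (for e < t), which has gcd(q, s_e) = gcd(k, s_e) = d_e elements because
-- s_e ∣ ρ ∣ q - k, and must differ from the earlier entries.  Since s_e ∣ s_{e'} for e' ≤ e,
-- the earlier entries avoid the s_{e'}-torsion and hence the s_e-torsion, so exactly
-- d_e + e values are excluded at step e, giving the factor q - d_e - e.

open import Defs
open import Data.Nat as N using (ℕ; zero; suc; _≤_; _<_; _*_; _+_; _∸_; _/_; NonZero; z≤n; s≤s; _<?_; _≤?_)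
import Data.Nat.Properties as NP
import Data.Nat.DivMod as DM
open import Data.Nat.Divisibility as ND using (_∣_; _∣?_; ∣-trans)
open import Data.Nat.GCD using (gcd; gcd[m,n]∣m; gcd[m,n]∣n; gcd-greatest; gcd[m,n]≢0)
open import Data.Nat.Coprimality using (Coprime; coprime-divisor; coprime-/gcd)
open import Data.Nat.Solver renaming (module +-*-Solver to ℕ-Solver)
open import Data.Fin as Fin using (Fin; zero; suc; toℕ; fromℕ<; inject≤)
import Data.Fin.Properties as FP
open import Data.Integer as ℤ using (ℤ; +_; -[1+_]; _-_)
import Data.Integer.Properties as ZP
open import Data.Integer.Solver renaming (module +-*-Solver to ℤ-Solver)
open import Data.Vec as V using (Vec; []; _∷_; tabulate; zipWith)
open import Data.List as L using (List; []; _∷_; _++_)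
import Data.List.Properties as LP
open import Data.List.Relation.Unary.All using (All; []; _∷_)
import Data.List.Relation.Unary.All.Properties as AP
open import Data.Bool as B using (Bool; true; false; not; _∧_; _∨_; if_then_else_)
open import Data.Bool.Properties using (∧-conicalˡ; ∧-conicalʳ; ∨-conicalˡ; ∨-conicalʳ; ⇔→≡)
open import Data.Empty using (⊥-elim)
open import Data.Sum using (inj₁)
open import Data.Product using (_×_; _,_; proj₁; proj₂)
open import Function.Base using (case_of_)
open import Function.Bundles using (_⇔_; mk⇔; Equivalence)
open import Relation.Nullary using (Dec; yes; no; ¬_; does)
open import Relation.Nullary.Decidable using (dec-true; dec-false; does-⇔)
open import Relation.Binary.Definitions using (tri<; tri≈; tri>)
open import Relation.Binary.PropositionalEquality
  using (_≡_; _≢_; refl; sym; trans; cong; cong₂; subst; subst₂; module ≡-Reasoning)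

dec-true⁻¹ : ∀ {A : Set} (a? : Dec A) → does a? ≡ true → A
dec-true⁻¹ (yes a) _ = a

dec-false⁻¹ : ∀ {A : Set} (a? : Dec A) → does a? ≡ false → ¬ A
dec-false⁻¹ (no ¬a) _ = ¬a

not-∨-true : ∀ x y → not (x ∨ y) ≡ true → x ≡ false × y ≡ false
not-∨-true false false _ = refl , refl

𝟙 : Bool → ℕ
𝟙 b = if b then 1 else 0

countList : {A : Set} → (A → Bool) → List A → ℕ
countList p []       = 0
countList p (x ∷ xs) = 𝟙 (p x) + countList p xs

length-filter≡countList : {A : Set} (p : A → Bool) (xs : List A) →
  L.length (L.filter (λ x → p x B.≟ true) xs) ≡ countList p xs
length-filter≡countList p [] = refl
length-filter≡countList p (x ∷ xs) with p x
... | true  = cong suc (length-filter≡countList p xs)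
... | false = length-filter≡countList p xs

countList-cong : {A : Set} {p p′ : A → Bool} → (∀ x → p x ≡ p′ x) → ∀ xs →
  countList p xs ≡ countList p′ xs
countList-cong p≗p′ []       = refl
countList-cong p≗p′ (x ∷ xs) = cong₂ (λ b n → 𝟙 b + n) (p≗p′ x) (countList-cong p≗p′ xs)

countList-++ : {A : Set} (p : A → Bool) (xs ys : List A) →
  countList p (xs ++ ys) ≡ countList p xs + countList p ys
countList-++ p []       ys = refl
countList-++ p (x ∷ xs) ys =
  trans (cong (N._+_ (𝟙 (p x))) (countList-++ p xs ys)) (sym (NP.+-assoc (𝟙 (p x)) _ _))

countList-map : {A C : Set} (p : C → Bool) (f : A → C) (xs : List A) →
  countList p (L.map f xs) ≡ countList (λ x → p (f x)) xs
countList-map p f []       = refl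
countList-map p f (x ∷ xs) = cong (N._+_ (𝟙 (p (f x)))) (countList-map p f xs)

countList-∧ : {A : Set} (b : Bool) (p : A → Bool) (xs : List A) →
  countList (λ x → b ∧ p x) xs ≡ (if b then countList p xs else 0)
countList-∧ true  p xs       = refl
countList-∧ false p []       = refl
countList-∧ false p (x ∷ xs) = countList-∧ false p xs

countFin : ∀ {n} → (Fin n → Bool) → ℕ
countFin {zero}  p = 0
countFin {suc n} p = 𝟙 (p zero) + countFin (λ i → p (suc i))

sumFin : ∀ {n} → (Fin n → ℕ) → ℕ
sumFin {zero}  f = 0
sumFin {suc n} f = f zero + sumFin (λ i → f (suc i))

countList-concatMap-tabulate : ∀ {A C : Set} {n} (p : C → Bool) (f : A → List C) (g : Fin n → A) →
  countList p (L.concatMap f (L.tabulate g)) ≡ sumFin (λ i → countList p (f (g i)))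
countList-concatMap-tabulate {n = zero}  p f g = refl
countList-concatMap-tabulate {n = suc n} p f g =
  trans (countList-++ p (f (g zero)) _)
        (cong (N._+_ (countList p (f (g zero)))) (countList-concatMap-tabulate p f (λ i → g (suc i))))

countFin-cong : ∀ {n} {p p′ : Fin n → Bool} → (∀ i → p i ≡ p′ i) → countFin p ≡ countFin p′
countFin-cong {zero}  p≗p′ = refl
countFin-cong {suc n} p≗p′ =
  cong₂ (λ b c → 𝟙 b + c) (p≗p′ zero) (countFin-cong (λ i → p≗p′ (suc i)))

sumFin-cong : ∀ {n} {f g : Fin n → ℕ} → (∀ i → f i ≡ g i) → sumFin f ≡ sumFin g
sumFin-cong {zero}  f≗g = refl
sumFin-cong {suc n} f≗g = cong₂ _+_ (f≗g zero) (sumFin-cong (λ i → f≗g (suc i)))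

countFin-false : ∀ n → countFin {n} (λ _ → false) ≡ 0
countFin-false zero    = refl
countFin-false (suc n) = countFin-false n

countFin-≟ : ∀ {n} (a : Fin n) → countFin (λ b → does (b Fin.≟ a)) ≡ 1
countFin-≟ {suc n} zero    = cong suc (countFin-false n)
countFin-≟ {suc n} (suc a) = countFin-≟ a

countFin-∨-disjoint : ∀ {n} (p p′ : Fin n → Bool) → (∀ i → p i ≡ true → p′ i ≡ false) →
  countFin (λ i → p i ∨ p′ i) ≡ countFin p + countFin p′
countFin-∨-disjoint {zero} p p′ disj = refl
countFin-∨-disjoint {suc n} p p′ disj
  with p zero | p′ zero | disj zero
     | countFin-∨-disjoint (λ i → p (suc i)) (λ i → p′ (suc i)) (λ i → disj (suc i))
... | true  | true  | disj₀ | ih with () ← disj₀ refl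
... | true  | false | _     | ih = cong suc ih
... | false | true  | _     | ih = trans (cong suc ih) (sym (NP.+-suc _ _))
... | false | false | _     | ih = ih

countFin-not+countFin : ∀ {n} (p : Fin n → Bool) → countFin (λ i → not (p i)) + countFin p ≡ n
countFin-not+countFin {zero}  p = refl
countFin-not+countFin {suc n} p with p zero | countFin-not+countFin (λ i → p (suc i))
... | true  | ih = trans (NP.+-suc _ _) (cong suc ih)
... | false | ih = cong suc ih

sumFin-if-constant : ∀ {n} (p : Fin n → Bool) (f : Fin n → ℕ) (z : ℤ) → (∀ i → p i ≡ true → + f i ≡ z) →
  + sumFin (λ i → if p i then f i else 0) ≡ + countFin p ℤ.* z
sumFin-if-constant {zero} p f z f≡z = refl
sumFin-if-constant {suc n} p f z f≡z
  with p zero | f≡z zero | sumFin-if-constant (λ i → p (suc i)) (λ i → f (suc i)) z (λ i → f≡z (suc i))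
... | false | _   | ih = ih
... | true  | f₀≡z | ih = begin
    + (f zero + _)          ≡⟨ ZP.pos-+ (f zero) _ ⟩
    + f zero ℤ.+ + _        ≡⟨ cong₂ ℤ._+_ (f₀≡z refl) ih ⟩
    z ℤ.+ + c ℤ.* z         ≡⟨ cong (ℤ._+ + c ℤ.* z) (sym (ZP.*-identityˡ z)) ⟩
    + 1 ℤ.* z ℤ.+ + c ℤ.* z ≡⟨ sym (ZP.*-distribʳ-+ z (+ 1) (+ c)) ⟩
    + (1 + c) ℤ.* z         ∎
  where
  open ≡-Reasoning
  c : ℕ
  c = countFin (λ i → p (suc i))

sum≡⇒pos≡sub : ∀ x c e q → x + (c + e) ≡ q → + x ≡ + q - + c - + e
sum≡⇒pos≡sub x c e q sum≡q = begin
    + x                                     ≡⟨ solve 3 (λ x c e → x := (x :+ (c :+ e)) :- c :- e) refl (+ x) (+ c) (+ e) ⟩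
    (+ x ℤ.+ (+ c ℤ.+ + e)) - + c - + e     ≡⟨ cong (λ z → z - + c - + e) (sym (ZP.pos-+ x (c + e))) ⟩
    + (x + (c + e)) - + c - + e             ≡⟨ cong (λ z → + z - + c - + e) sum≡q ⟩
    + q - + c - + e                         ∎
  where
  open ≡-Reasoning
  open ℤ-Solver

foldr-* : List ℤ → ℤ
foldr-* = L.foldr ℤ._*_ (+ 1)

applyUpTo-cong : ∀ {A : Set} {f g : ℕ → A} n → (∀ i → f i ≡ g i) → L.applyUpTo f n ≡ L.applyUpTo g n
applyUpTo-cong zero    f≗g = refl
applyUpTo-cong (suc n) f≗g = cong₂ _∷_ (f≗g 0) (applyUpTo-cong n (λ i → f≗g (suc i)))

tabulate-toℕ : ∀ {A : Set} n (f : ℕ → A) → L.tabulate {n = n} (λ j → f (toℕ j)) ≡ L.applyUpTo f n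
tabulate-toℕ zero    f = refl
tabulate-toℕ (suc n) f = cong (f 0 ∷_) (tabulate-toℕ n (λ i → f (suc i)))

applyUpTo-+ : ∀ {A : Set} (f : ℕ → A) a b → L.applyUpTo f (a + b) ≡ L.applyUpTo f a ++ L.applyUpTo (λ i → f (a + i)) b
applyUpTo-+ f zero    b = refl
applyUpTo-+ f (suc a) b = cong (f 0 ∷_) (applyUpTo-+ (λ i → f (suc i)) a b)

module InjectiveAvoidingCount
  (q : ℕ) (forbidden : ℕ → Fin q → Bool) (size : ℕ → ℕ)
  (forbidden-anti : ∀ e a → forbidden (suc e) a ≡ true → forbidden e a ≡ true)
  (countFin-forbidden : ∀ e → countFin (forbidden e) ≡ size e) where

  _∈ᵇ_ : Fin q → List (Fin q) → Bool
  a ∈ᵇ []      = false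
  a ∈ᵇ (b ∷ F) = does (a Fin.≟ b) ∨ a ∈ᵇ F

  allowed : ℕ → List (Fin q) → Fin q → Bool
  allowed e F a = not (forbidden e a ∨ a ∈ᵇ F)

  -- e is the position of the head of y in the whole vector, F the list of entries before it.
  admissibleᵇ : ∀ {r} → ℕ → List (Fin q) → Vec (Fin q) r → Bool
  admissibleᵇ e F []      = true
  admissibleᵇ e F (a ∷ y) = allowed e F a ∧ admissibleᵇ (suc e) (a ∷ F) y

  Admissible : ∀ {r} → ℕ → List (Fin q) → Vec (Fin q) r → Set
  Admissible {r} e F y = (∀ (j : Fin r) → forbidden (e + toℕ j) (V.lookup y j) ≡ false)
                       × (∀ (i j : Fin r) → toℕ i < toℕ j → V.lookup y i ≢ V.lookup y j)
                       × (∀ (j : Fin r) → V.lookup y j ∈ᵇ F ≡ false)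

  admissibleᵇ⇒Admissible : ∀ {r} e F (y : Vec (Fin q) r) → admissibleᵇ e F y ≡ true → Admissible e F y
  admissibleᵇ⇒Admissible e F [] _ = (λ ()) , (λ ()) , (λ ())
  admissibleᵇ⇒Admissible e F (a ∷ y) adm
    with not-∨-true (forbidden e a) (a ∈ᵇ F) (∧-conicalˡ _ _ adm)
       | admissibleᵇ⇒Admissible (suc e) (a ∷ F) y (∧-conicalʳ _ _ adm)
  ... | a∉forbidden , a∉F | y∉forbidden , y-distinct , y∉a∷F = avoids , distinct , ∉F
    where
    avoids : ∀ j → forbidden (e + toℕ j) (V.lookup (a ∷ y) j) ≡ false
    avoids zero    = subst (λ z → forbidden z a ≡ false) (sym (NP.+-identityʳ e)) a∉forbidden
    avoids (suc j) = subst (λ z → forbidden z (V.lookup y j) ≡ false) (sym (NP.+-suc e (toℕ j))) (y∉forbidden j)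
    distinct : ∀ i j → toℕ i < toℕ j → V.lookup (a ∷ y) i ≢ V.lookup (a ∷ y) j
    distinct zero    (suc j) _         a≡yⱼ = dec-false⁻¹ (_ Fin.≟ a) (∨-conicalˡ _ _ (y∉a∷F j)) (sym a≡yⱼ)
    distinct (suc i) (suc j) (s≤s i<j) = y-distinct i j i<j
    ∉F : ∀ j → V.lookup (a ∷ y) j ∈ᵇ F ≡ false
    ∉F zero    = a∉F
    ∉F (suc j) = ∨-conicalʳ _ _ (y∉a∷F j)

  Admissible⇒admissibleᵇ : ∀ {r} e F (y : Vec (Fin q) r) → Admissible e F y → admissibleᵇ e F y ≡ true
  Admissible⇒admissibleᵇ e F [] _ = refl
  Admissible⇒admissibleᵇ e F (a ∷ y) (avoids , distinct , ∉F)
    rewrite subst (λ z → forbidden z a ≡ false) (NP.+-identityʳ e) (avoids zero) | ∉F zero =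
    Admissible⇒admissibleᵇ (suc e) (a ∷ F) y (avoids′ , distinct′ , ∉a∷F)
    where
    avoids′ : ∀ j → forbidden (suc e + toℕ j) (V.lookup y j) ≡ false
    avoids′ j = subst (λ z → forbidden z (V.lookup y j) ≡ false) (NP.+-suc e (toℕ j)) (avoids (suc j))
    distinct′ : ∀ i j → toℕ i < toℕ j → V.lookup y i ≢ V.lookup y j
    distinct′ i j i<j = distinct (suc i) (suc j) (s≤s i<j)
    ∉a∷F : ∀ j → V.lookup y j ∈ᵇ (a ∷ F) ≡ false
    ∉a∷F j rewrite dec-false (V.lookup y j Fin.≟ a) (λ yⱼ≡a → distinct zero (suc j) (s≤s z≤n) (sym yⱼ≡a))
                 | ∉F (suc j) = refl

  factor : ℕ → ℤ
  factor e = + q - + size e - + e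

  prodFrom : ℕ → ℕ → ℤ
  prodFrom e zero    = + 1
  prodFrom e (suc r) = factor e ℤ.* prodFrom (suc e) r

  Invariant : ℕ → List (Fin q) → Set
  Invariant e F = (∀ a → a ∈ᵇ F ≡ true → forbidden e a ≡ false) × countFin (_∈ᵇ F) ≡ e

  countFin-allowed : ∀ e F → Invariant e F → countFin (allowed e F) + (size e + e) ≡ q
  countFin-allowed e F (F∉forbidden , #F) = begin
      countFin (allowed e F) + (size e + e)
        ≡⟨ cong (N._+_ (countFin (allowed e F))) (sym (cong₂ _+_ (countFin-forbidden e) #F)) ⟩
      countFin (allowed e F) + (countFin (forbidden e) + countFin (_∈ᵇ F))
        ≡⟨ cong (N._+_ (countFin (allowed e F))) (sym (countFin-∨-disjoint (forbidden e) (_∈ᵇ F) disjoint)) ⟩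
      countFin (allowed e F) + countFin (λ a → forbidden e a ∨ a ∈ᵇ F)
        ≡⟨ countFin-not+countFin (λ a → forbidden e a ∨ a ∈ᵇ F) ⟩
      q ∎
    where
    open ≡-Reasoning
    disjoint : ∀ a → forbidden e a ≡ true → a ∈ᵇ F ≡ false
    disjoint a a∈forbidden with a ∈ᵇ F in a∈F?
    ... | false = refl
    ... | true with () ← trans (sym a∈forbidden) (F∉forbidden a a∈F?)

  forbidden-anti-false : ∀ e a → forbidden e a ≡ false → forbidden (suc e) a ≡ false
  forbidden-anti-false e a a∉ with forbidden (suc e) a in a∈?
  ... | false = refl
  ... | true with () ← trans (sym (forbidden-anti e a a∈?)) a∉

  Invariant-∷ : ∀ e F a → Invariant e F → allowed e F a ≡ true → Invariant (suc e) (a ∷ F)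
  Invariant-∷ e F a (F∉forbidden , #F) a-allowed = a∷F∉forbidden , #a∷F
    where
    a∉ : forbidden e a ≡ false × a ∈ᵇ F ≡ false
    a∉ = not-∨-true (forbidden e a) (a ∈ᵇ F) a-allowed
    a∷F∉forbidden : ∀ b → b ∈ᵇ (a ∷ F) ≡ true → forbidden (suc e) b ≡ false
    a∷F∉forbidden b b∈a∷F with b Fin.≟ a
    ... | yes refl = forbidden-anti-false e b (proj₁ a∉)
    ... | no _     = forbidden-anti-false e b (F∉forbidden b b∈a∷F)
    #a∷F : countFin (_∈ᵇ (a ∷ F)) ≡ suc e
    #a∷F = begin
      countFin (λ b → does (b Fin.≟ a) ∨ b ∈ᵇ F)
        ≡⟨ countFin-∨-disjoint (λ b → does (b Fin.≟ a)) (_∈ᵇ F)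
             (λ b b≡a → subst (λ z → z ∈ᵇ F ≡ false) (sym (dec-true⁻¹ (b Fin.≟ a) b≡a)) (proj₂ a∉)) ⟩
      countFin (λ b → does (b Fin.≟ a)) + countFin (_∈ᵇ F)
        ≡⟨ cong₂ _+_ (countFin-≟ a) #F ⟩
      suc e ∎
      where open ≡-Reasoning

  countList-admissibleᵇ : ∀ r e F → Invariant e F → + countList (admissibleᵇ e F) (allVecs r q) ≡ prodFrom e r
  countList-admissibleᵇ zero    e F inv = refl
  countList-admissibleᵇ (suc r) e F inv = begin
      + countList (admissibleᵇ e F) (allVecs (suc r) q)
        ≡⟨ cong +_ (countList-concatMap-tabulate (admissibleᵇ e F) (λ a → L.map (a ∷_) (allVecs r q)) (λ a → a)) ⟩
      + sumFin (λ a → countList (admissibleᵇ e F) (L.map (a ∷_) (allVecs r q)))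
        ≡⟨ cong +_ (sumFin-cong split-head) ⟩
      + sumFin (λ a → if allowed e F a then continuations a else 0)
        ≡⟨ sumFin-if-constant (allowed e F) continuations (prodFrom (suc e) r) continuations≡ ⟩
      + countFin (allowed e F) ℤ.* prodFrom (suc e) r
        ≡⟨ cong (ℤ._* prodFrom (suc e) r) #allowed ⟩
      factor e ℤ.* prodFrom (suc e) r ∎
    where
    open ≡-Reasoning
    continuations : Fin q → ℕ
    continuations a = countList (admissibleᵇ (suc e) (a ∷ F)) (allVecs r q)
    split-head : ∀ a → countList (admissibleᵇ e F) (L.map (a ∷_) (allVecs r q))
                     ≡ (if allowed e F a then continuations a else 0)
    split-head a = trans (countList-map (admissibleᵇ e F) (a ∷_) (allVecs r q))
                         (countList-∧ (allowed e F a) (admissibleᵇ (suc e) (a ∷ F)) (allVecs r q))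
    continuations≡ : ∀ a → allowed e F a ≡ true → + continuations a ≡ prodFrom (suc e) r
    continuations≡ a a-allowed = countList-admissibleᵇ r (suc e) (a ∷ F) (Invariant-∷ e F a inv a-allowed)
    #allowed : + countFin (allowed e F) ≡ factor e
    #allowed = sum≡⇒pos≡sub (countFin (allowed e F)) (size e) e q (countFin-allowed e F inv)

  prodFrom-+ : ∀ e a b → prodFrom e (a + b) ≡ prodFrom e a ℤ.* prodFrom (e + a) b
  prodFrom-+ e zero    b = sym (trans (ZP.*-identityˡ _) (cong (λ z → prodFrom z b) (NP.+-identityʳ e)))
  prodFrom-+ e (suc a) b = begin
      factor e ℤ.* prodFrom (suc e) (a + b)                             ≡⟨ cong (factor e ℤ.*_) (prodFrom-+ (suc e) a b) ⟩
      factor e ℤ.* (prodFrom (suc e) a ℤ.* prodFrom (suc e + a) b)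
        ≡⟨ sym (ZP.*-assoc (factor e) (prodFrom (suc e) a) (prodFrom (suc e + a) b)) ⟩
      factor e ℤ.* prodFrom (suc e) a ℤ.* prodFrom (suc e + a) b
        ≡⟨ cong (λ z → factor e ℤ.* prodFrom (suc e) a ℤ.* prodFrom z b) (sym (NP.+-suc e a)) ⟩
      factor e ℤ.* prodFrom (suc e) a ℤ.* prodFrom (e + suc a) b        ∎
    where open ≡-Reasoning

  prodFrom≡foldr-* : ∀ e r → prodFrom e r ≡ foldr-* (L.applyUpTo (λ i → factor (e + i)) r)
  prodFrom≡foldr-* e zero    = refl
  prodFrom≡foldr-* e (suc r) = cong₂ ℤ._*_ (cong factor (sym (NP.+-identityʳ e)))
    (trans (prodFrom≡foldr-* (suc e) r) (cong foldr-* (applyUpTo-cong r (λ i → cong factor (sym (NP.+-suc e i))))))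

countBelow : (ℕ → Bool) → ℕ → ℕ
countBelow p zero    = 0
countBelow p (suc n) = 𝟙 (p 0) + countBelow (λ x → p (suc x)) n

countFin-toℕ : ∀ n (p : ℕ → Bool) → countFin {n} (λ a → p (toℕ a)) ≡ countBelow p n
countFin-toℕ zero    p = refl
countFin-toℕ (suc n) p = cong (N._+_ (𝟙 (p 0))) (countFin-toℕ n (λ x → p (suc x)))

countBelow-cong : ∀ n {p p′ : ℕ → Bool} → (∀ x → p x ≡ p′ x) → countBelow p n ≡ countBelow p′ n
countBelow-cong zero    p≗p′ = refl
countBelow-cong (suc n) p≗p′ = cong₂ (λ b c → 𝟙 b + c) (p≗p′ 0) (countBelow-cong n (λ x → p≗p′ (suc x)))

countBelow-+ : ∀ m n (p : ℕ → Bool) → countBelow p (m + n) ≡ countBelow p m + countBelow (λ x → p (m + x)) n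
countBelow-+ zero    n p = refl
countBelow-+ (suc m) n p =
  trans (cong (N._+_ (𝟙 (p 0))) (countBelow-+ m n (λ x → p (suc x)))) (sym (NP.+-assoc (𝟙 (p 0)) _ _))

countBelow-none : ∀ n (p : ℕ → Bool) → (∀ x → x < n → p x ≡ false) → countBelow p n ≡ 0
countBelow-none zero    p none = refl
countBelow-none (suc n) p none rewrite none 0 (s≤s z≤n) =
  countBelow-none n (λ x → p (suc x)) (λ x x<n → none (suc x) (s≤s x<n))

countBelow-∣ : ∀ g d .{{_ : NonZero d}} → countBelow (λ a → does (d ∣? a)) (g * d) ≡ g
countBelow-∣ zero    d = refl
countBelow-∣ (suc g) d@(suc d′) = begin
    countBelow d∣ (d + g * d)                                   ≡⟨ countBelow-+ d (g * d) d∣ ⟩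
    countBelow d∣ d + countBelow (λ x → d∣ (d + x)) (g * d)     ≡⟨ cong₂ _+_ one-in-first-block shifted ⟩
    suc g                                                       ∎
  where
  open ≡-Reasoning
  d∣ : ℕ → Bool
  d∣ a = does (d ∣? a)
  one-in-first-block : countBelow d∣ d ≡ 1
  one-in-first-block rewrite dec-true (d ∣? 0) (d ND.∣0) =
    cong suc (countBelow-none d′ (λ x → d∣ (suc x))
                (λ x x<d′ → dec-false (d ∣? suc x) (λ d∣1+x → NP.<⇒≱ (s≤s x<d′) (ND.∣⇒≤ d∣1+x))))
  d∣-periodic : ∀ x → d∣ (d + x) ≡ d∣ x
  d∣-periodic x = does-⇔ (mk⇔ (λ h → ND.∣m+n∣m⇒∣n h ND.∣-refl) (ND.∣m∣n⇒∣m+n ND.∣-refl)) (d ∣? (d + x)) (d ∣? x)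
  shifted : countBelow (λ x → d∣ (d + x)) (g * d) ≡ g
  shifted = trans (countBelow-cong (g * d) d∣-periodic) (countBelow-∣ g d)

*-coprime-∣⇔ : ∀ g {Q′ s′} x .{{_ : NonZero g}} → Coprime Q′ s′ → (g * Q′ ∣ x * (g * s′)) ⇔ (Q′ ∣ x)
*-coprime-∣⇔ g {Q′} {s′} x coprime = mk⇔
  (λ h → coprime-divisor coprime (ND.*-cancelˡ-∣ g (subst (g * Q′ ∣_) (reorder x g s′) h)))
  (λ h → subst (g * Q′ ∣_) (sym (reorder x g s′)) (ND.*-monoʳ-∣ g (∣-trans h (ND.n∣m*n s′))))
  where
  open ℕ-Solver
  reorder : ∀ x g s → x * (g * s) ≡ g * (s * x)
  reorder = solve 3 (λ x g s → x :* (g :* s) := g :* (s :* x)) refl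

torsion : (Q : ℕ) → ℕ → Fin Q → Bool
torsion Q s a = does (Q ∣? toℕ a * s)

torsion-∣ : ∀ Q {s′ s} (a : Fin Q) → s′ ∣ s → torsion Q s′ a ≡ true → torsion Q s a ≡ true
torsion-∣ Q a s′∣s a∈ = dec-true (Q ∣? _) (∣-trans (dec-true⁻¹ (Q ∣? _) a∈) (ND.*-monoʳ-∣ (toℕ a) s′∣s))

-- With g = gcd Q s, Q = g Q′ and s = g s′ for coprime Q′, s′, and Q ∣ a s iff Q′ ∣ a.
countFin-torsion : ∀ Q s .{{_ : NonZero Q}} → countFin (torsion Q s) ≡ gcd Q s
countFin-torsion Q s = begin
    countFin (torsion Q s)                         ≡⟨ countFin-toℕ Q (λ x → does (Q ∣? x * s)) ⟩
    countBelow (λ x → does (Q ∣? x * s)) Q         ≡⟨ countBelow-cong Q (λ x → does-⇔ (Q∣xs⇔Q′∣x x) (Q ∣? x * s) (Q′ ∣? x)) ⟩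
    countBelow (λ x → does (Q′ ∣? x)) Q            ≡⟨ cong (countBelow (λ x → does (Q′ ∣? x))) Q≡gQ′ ⟩
    countBelow (λ x → does (Q′ ∣? x)) (g * Q′)     ≡⟨ countBelow-∣ g Q′ ⟩
    g                                              ∎
  where
  open ≡-Reasoning
  g : ℕ
  g = gcd Q s
  instance
    g≢0 : NonZero g
    g≢0 = N.≢-nonZero (gcd[m,n]≢0 Q s (inj₁ (N.≢-nonZero⁻¹ Q)))
  Q′ s′ : ℕ
  Q′ = Q / g
  s′ = s / g
  Q≡gQ′ : Q ≡ g * Q′
  Q≡gQ′ = sym (DM.m*[n/m]≡n (gcd[m,n]∣m Q s))
  instance
    Q′≢0 : NonZero Q′
    Q′≢0 = N.≢-nonZero (λ Q′≡0 → N.≢-nonZero⁻¹ Q (trans Q≡gQ′ (trans (cong (g *_) Q′≡0) (NP.*-zeroʳ g))))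
  Q∣xs⇔Q′∣x : ∀ x → (Q ∣ x * s) ⇔ (Q′ ∣ x)
  Q∣xs⇔Q′∣x x = mk⇔ (λ h → Equivalence.to   g-cancelled (subst₂ _∣_ Q≡gQ′ xs≡xgs′ h))
                     (λ h → subst₂ _∣_ (sym Q≡gQ′) (sym xs≡xgs′) (Equivalence.from g-cancelled h))
    where
    g-cancelled : (g * Q′ ∣ x * (g * s′)) ⇔ (Q′ ∣ x)
    g-cancelled = *-coprime-∣⇔ g x (coprime-/gcd Q s)
    xs≡xgs′ : x * s ≡ x * (g * s′)
    xs≡xgs′ = cong (x *_) (sym (DM.m*[n/m]≡n (gcd[m,n]∣n Q s)))

gcd-+-multiple : ∀ k s r n → s ∣ r → gcd (k + r * n) s ≡ gcd k s
gcd-+-multiple k s r n s∣r = ND.∣-antisym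
  (gcd-greatest (ND.∣m+n∣m⇒∣n (subst (gcd (k + r * n) s ∣_) (NP.+-comm k (r * n)) (gcd[m,n]∣m (k + r * n) s))
                               (∣-trans (gcd[m,n]∣n (k + r * n) s) s∣rn))
                (gcd[m,n]∣n (k + r * n) s))
  (gcd-greatest (ND.∣m∣n⇒∣m+n (gcd[m,n]∣m k s) (∣-trans (gcd[m,n]∣n k s) s∣rn)) (gcd[m,n]∣n k s))
  where
  s∣rn : s ∣ r * n
  s∣rn = ∣-trans s∣r (ND.m∣m*n n)

dot-map-* : ∀ {n q} (x : Vec (Fin q) n) (c : ℤ) (v : Vec ℤ n) → dot x (V.map (c ℤ.*_) v) ≡ c ℤ.* dot x v
dot-map-* []      c []      = sym (ZP.*-zeroʳ c)
dot-map-* (a ∷ x) c (u ∷ v) = begin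
    + toℕ a ℤ.* (c ℤ.* u) ℤ.+ dot x (V.map (c ℤ.*_) v) ≡⟨ cong (ℤ._+_ (+ toℕ a ℤ.* (c ℤ.* u))) (dot-map-* x c v) ⟩
    + toℕ a ℤ.* (c ℤ.* u) ℤ.+ c ℤ.* dot x v             ≡⟨ factor-out (+ toℕ a) c u (dot x v) ⟩
    c ℤ.* (+ toℕ a ℤ.* u ℤ.+ dot x v)                   ∎
  where
  open ≡-Reasoning
  open ℤ-Solver
  factor-out : ∀ a c u d → a ℤ.* (c ℤ.* u) ℤ.+ c ℤ.* d ≡ c ℤ.* (a ℤ.* u ℤ.+ d)
  factor-out = solve 4 (λ a c u d → a :* (c :* u) :+ c :* d := c :* (a :* u :+ d)) refl

dot-zipWith-- : ∀ {n q} (x : Vec (Fin q) n) (u v : Vec ℤ n) → dot x (zipWith _-_ u v) ≡ dot x u - dot x v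
dot-zipWith-- []      []      []      = refl
dot-zipWith-- (a ∷ x) (u ∷ us) (v ∷ vs) = begin
    + toℕ a ℤ.* (u - v) ℤ.+ dot x (zipWith _-_ us vs)   ≡⟨ cong (ℤ._+_ (+ toℕ a ℤ.* (u - v))) (dot-zipWith-- x us vs) ⟩
    + toℕ a ℤ.* (u - v) ℤ.+ (dot x us - dot x vs)       ≡⟨ regroup (+ toℕ a) u v (dot x us) (dot x vs) ⟩
    (+ toℕ a ℤ.* u ℤ.+ dot x us) - (+ toℕ a ℤ.* v ℤ.+ dot x vs) ∎
  where
  open ≡-Reasoning
  open ℤ-Solver
  regroup : ∀ a u v d e → a ℤ.* (u - v) ℤ.+ (d - e) ≡ (a ℤ.* u ℤ.+ d) - (a ℤ.* v ℤ.+ e)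
  regroup = solve 5 (λ a u v d e → a :* (u :- v) :+ (d :- e) := (a :* u :+ d) :- (a :* v :+ e)) refl

dot-zeros : ∀ {n q} (x : Vec (Fin q) n) → dot x (tabulate (λ _ → + 0)) ≡ + 0
dot-zeros []      = refl
dot-zeros (a ∷ x) = cong₂ ℤ._+_ (ZP.*-zeroʳ (+ toℕ a)) (dot-zeros x)

dot-unitVec : ∀ {n q} (x : Vec (Fin q) n) (i : Fin n) → dot x (unitVec i) ≡ + toℕ (V.lookup x i)
dot-unitVec (a ∷ x) zero = begin
    + toℕ a ℤ.* + 1 ℤ.+ dot x (tabulate (λ _ → + 0)) ≡⟨ cong₂ ℤ._+_ (ZP.*-identityʳ (+ toℕ a)) (dot-zeros x) ⟩
    + toℕ a ℤ.+ + 0                                 ≡⟨ ZP.+-identityʳ (+ toℕ a) ⟩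
    + toℕ a                                         ∎
  where open ≡-Reasoning
dot-unitVec (a ∷ x) (suc i) = trans (cong₂ ℤ._+_ (ZP.*-zeroʳ (+ toℕ a)) (dot-unitVec x i)) (ZP.+-identityˡ _)

dot-scaledUnit : ∀ {n q} (x : Vec (Fin q) n) (i : Fin n) (s : ℕ) →
  dot x (V.map (+ s ℤ.*_) (unitVec i)) ≡ + (toℕ (V.lookup x i) * s)
dot-scaledUnit x i s = begin
    dot x (V.map (+ s ℤ.*_) (unitVec i)) ≡⟨ dot-map-* x (+ s) (unitVec i) ⟩
    + s ℤ.* dot x (unitVec i)            ≡⟨ cong (+ s ℤ.*_) (dot-unitVec x i) ⟩
    + s ℤ.* + toℕ (V.lookup x i)         ≡⟨ sym (ZP.pos-* s _) ⟩
    + (s * toℕ (V.lookup x i))           ≡⟨ cong +_ (NP.*-comm s _) ⟩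
    + (toℕ (V.lookup x i) * s)           ∎
  where open ≡-Reasoning

dot-unitDiff : ∀ {n q} (x : Vec (Fin q) n) (i j : Fin n) →
  dot x (zipWith _-_ (unitVec i) (unitVec j)) ≡ + toℕ (V.lookup x i) - + toℕ (V.lookup x j)
dot-unitDiff x i j =
  trans (dot-zipWith-- x (unitVec i) (unitVec j)) (cong₂ _-_ (dot-unitVec x i) (dot-unitVec x j))

isZeroMod-diff⇒≡ : ∀ {q′} (a b : Fin (suc q′)) → isZeroMod (+ toℕ a - + toℕ b) (suc q′) ≡ true → a ≡ b
isZeroMod-diff⇒≡ {q′} a b zero-mod with NP.<-cmp (toℕ a) (toℕ b)
... | tri≈ _ a≡b _ = FP.toℕ-injective a≡b
... | tri> _ _ b<a = ⊥-elim (NP.m>n⇒m∸n≢0 b<a a∸b≡0)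
  where
  a-b≡a∸b : + toℕ a - + toℕ b ≡ + (toℕ a ∸ toℕ b)
  a-b≡a∸b = trans (ZP.m-n≡m⊖n (toℕ a) (toℕ b)) (ZP.⊖-≥ (NP.<⇒≤ b<a))
  a∸b≡0 : toℕ a ∸ toℕ b ≡ 0
  a∸b≡0 = trans (sym (DM.m<n⇒m%n≡m (NP.≤-<-trans (NP.m∸n≤m (toℕ a) (toℕ b)) (FP.toℕ<n a))))
                (dec-true⁻¹ (_ N.≟ 0) (subst (λ z → isZeroMod z (suc q′) ≡ true) a-b≡a∸b zero-mod))
... | tri< a<b _ _ with toℕ b ∸ toℕ a in b∸a≡ | NP.m>n⇒m∸n≢0 a<b
...   | zero  | b∸a≢0 = ⊥-elim (b∸a≢0 refl)
...   | suc w | _     = ⊥-elim (NP.m>n⇒m∸n≢0 1+w<Q Q∸[1+w]≡0)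
  where
  1+w<Q : suc w < suc q′
  1+w<Q = subst (_< suc q′) b∸a≡ (NP.≤-<-trans (NP.m∸n≤m (toℕ b) (toℕ a)) (FP.toℕ<n b))
  a-b≡-[1+w] : + toℕ a - + toℕ b ≡ -[1+ w ]
  a-b≡-[1+w] = trans (ZP.m-n≡m⊖n (toℕ a) (toℕ b)) (trans (ZP.⊖-< a<b) (cong (λ z → ℤ.- (+ z)) b∸a≡))
  -[1+w]%Q : -[1+ w ] ℤ.%ℕ suc q′ ≡ suc q′ ∸ suc w
  -[1+w]%Q rewrite DM.m<n⇒m%n≡m 1+w<Q = refl
  Q∸[1+w]≡0 : suc q′ ∸ suc w ≡ 0
  Q∸[1+w]≡0 = trans (sym -[1+w]%Q)
                    (dec-true⁻¹ (_ N.≟ 0) (subst (λ z → isZeroMod z (suc q′) ≡ true) a-b≡-[1+w] zero-mod))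

isZeroMod-diff-self : ∀ {q′} (a : Fin (suc q′)) → isZeroMod (+ toℕ a - + toℕ a) (suc q′) ≡ true
isZeroMod-diff-self a rewrite ZP.+-inverseʳ (+ toℕ a) = refl

NonzeroEntry : ∀ {m q} → Vec (Fin q) m → Vec ℤ m → Set
NonzeroEntry {q = q} x c = isZeroMod (dot x c) q ≡ false

allNonzero⇔All : ∀ {m q} (S : IntMatrix m) (x : Vec (Fin q) m) → (allNonzero S x ≡ true) ⇔ All (NonzeroEntry x) S
allNonzero⇔All []      x = mk⇔ (λ _ → []) (λ _ → refl)
allNonzero⇔All {q = q} (c ∷ S) x with isZeroMod (dot x c) q in c-entry
... | true  = mk⇔ (λ ()) (λ { (c-entry′ ∷ _) → case trans (sym c-entry) c-entry′ of λ () })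
... | false = mk⇔ (λ h → c-entry ∷ Equivalence.to (allNonzero⇔All S x) h)
                  (λ { (_ ∷ h) → Equivalence.from (allNonzero⇔All S x) h })

extend : ∀ {A : Set} {t} → (Fin t → A) → A → ℕ → A
extend {t = t} f default e with e <? t
... | yes e<t = f (fromℕ< e<t)
... | no  _   = default

extend-< : ∀ {A : Set} {t} (f : Fin t → A) default e (e<t : e < t) → extend f default e ≡ f (fromℕ< e<t)
extend-< {t = t} f default e e<t with e <? t
... | yes e<t′ = cong f (FP.fromℕ<-cong e e refl e<t′ e<t)
... | no  e≮t  = ⊥-elim (e≮t e<t)

extend-≮ : ∀ {A : Set} {t} (f : Fin t → A) default e → ¬ e < t → extend f default e ≡ default
extend-≮ {t = t} f default e e≮t with e <? t
... | yes e<t = ⊥-elim (e≮t e<t)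
... | no  _   = refl

module ColumnCount (m t : ℕ) (t≤m : t ≤ m) (s : Fin t → ℕ)
  (s-∣ : ∀ (i j : Fin t) → i Fin.≤ j → s j ∣ s i)
  (k q′ : ℕ) (gcd-q≡gcd-k : ∀ i → gcd (suc q′) (s i) ≡ gcd k (s i)) where

  Q : ℕ
  Q = suc q′

  forbidden : ℕ → Fin Q → Bool
  forbidden e a = extend (λ i → torsion Q (s i) a) false e

  size : ℕ → ℕ
  size = extend (λ i → gcd k (s i)) 0

  forbidden-anti : ∀ e a → forbidden (suc e) a ≡ true → forbidden e a ≡ true
  forbidden-anti e a a∈ = by-cases (suc e <? t)
    where
    by-cases : Dec (suc e < t) → forbidden e a ≡ true
    by-cases (no 1+e≮t) with () ← trans (sym (extend-≮ (λ i → torsion Q (s i) a) false (suc e) 1+e≮t)) a∈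
    by-cases (yes 1+e<t) = trans (extend-< (λ i → torsion Q (s i) a) false e e<t)
                                 (torsion-∣ Q a (s-∣ (fromℕ< e<t) (fromℕ< 1+e<t) ordered) a∈′)
      where
      e<t : e < t
      e<t = NP.<-trans (NP.n<1+n e) 1+e<t
      ordered : fromℕ< e<t Fin.≤ fromℕ< 1+e<t
      ordered = subst₂ _≤_ (sym (FP.toℕ-fromℕ< e<t)) (sym (FP.toℕ-fromℕ< 1+e<t)) (NP.n≤1+n e)
      a∈′ : torsion Q (s (fromℕ< 1+e<t)) a ≡ true
      a∈′ = trans (sym (extend-< (λ i → torsion Q (s i) a) false (suc e) 1+e<t)) a∈

  countFin-forbidden : ∀ e → countFin (forbidden e) ≡ size e
  countFin-forbidden e = by-cases (e <? t)
    where
    by-cases : Dec (e < t) → countFin (forbidden e) ≡ size e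
    by-cases (yes e<t) = begin
      countFin (forbidden e)                ≡⟨ countFin-cong (λ a → extend-< (λ i → torsion Q (s i) a) false e e<t) ⟩
      countFin (torsion Q (s (fromℕ< e<t))) ≡⟨ countFin-torsion Q (s (fromℕ< e<t)) ⟩
      gcd Q (s (fromℕ< e<t))                ≡⟨ gcd-q≡gcd-k (fromℕ< e<t) ⟩
      gcd k (s (fromℕ< e<t))                ≡⟨ sym (extend-< (λ i → gcd k (s i)) 0 e e<t) ⟩
      size e                                ∎
      where open ≡-Reasoning
    by-cases (no e≮t) = trans (countFin-cong (λ a → extend-≮ (λ i → torsion Q (s i) a) false e e≮t))
                              (trans (countFin-false Q) (sym (extend-≮ (λ i → gcd k (s i)) 0 e e≮t)))

  open InjectiveAvoidingCount Q forbidden size forbidden-anti countFin-forbidden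

  ColumnsNonzero : Vec (Fin Q) m → Set
  ColumnsNonzero x = (∀ (i : Fin t) → torsion Q (s i) (V.lookup x (inject≤ i t≤m)) ≡ false)
                   × (∀ (i j : Fin m) → toℕ i < toℕ j → V.lookup x i ≢ V.lookup x j)

  scaledColumn : Fin t → Vec ℤ m
  scaledColumn i = V.map (+ s i ℤ.*_) (unitVec (inject≤ i t≤m))

  diffColumn : Fin m → Fin m → Vec ℤ m
  diffColumn i j = zipWith _-_ (unitVec i) (unitVec j)

  columnIf : Bool → Vec ℤ m → List (Vec ℤ m)
  columnIf b c = if b then L.[ c ] else []

  diffColumns : List (Vec ℤ m)
  diffColumns = L.concatMap (λ i → L.concatMap (λ j → columnIf (does (toℕ i <? toℕ j)) (diffColumn i j))
                                                (L.allFin m))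
                            (L.allFin m)

  All⇒ColumnsNonzero : ∀ x → All (NonzeroEntry x) (A m t t≤m s) → ColumnsNonzero x
  All⇒ColumnsNonzero x all-nonzero = scaled-nonzero , distinct
    where
    scaled-part : All (NonzeroEntry x) (L.map scaledColumn (L.allFin t))
    scaled-part = proj₁ (AP.++⁻ (L.map scaledColumn (L.allFin t)) all-nonzero)
    diff-part : All (NonzeroEntry x) diffColumns
    diff-part   = proj₂ (AP.++⁻ (L.map scaledColumn (L.allFin t)) all-nonzero)
    scaled-nonzero : ∀ i → torsion Q (s i) (V.lookup x (inject≤ i t≤m)) ≡ false
    scaled-nonzero i = subst (λ z → isZeroMod z Q ≡ false) (dot-scaledUnit x (inject≤ i t≤m) (s i))
                             (AP.tabulate⁻ (AP.map⁻ scaled-part) i)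
    diff-nonzero : ∀ i j → All (NonzeroEntry x) (columnIf (does (toℕ i <? toℕ j)) (diffColumn i j))
    diff-nonzero i j = AP.tabulate⁻ (AP.map⁻ (AP.concat⁻ (AP.tabulate⁻ (AP.map⁻ (AP.concat⁻ diff-part)) i))) j
    distinct : ∀ i j → toℕ i < toℕ j → V.lookup x i ≢ V.lookup x j
    distinct i j i<j xᵢ≡xⱼ
      with subst (λ b → All (NonzeroEntry x) (columnIf b (diffColumn i j)))
                 (dec-true (toℕ i <? toℕ j) i<j) (diff-nonzero i j)
    ... | xᵢ-xⱼ≢0 ∷ [] with () ← trans (sym (subst (λ z → isZeroMod z Q ≡ false) (dot-unitDiff x i j) xᵢ-xⱼ≢0))
                                    (subst (λ z → isZeroMod (+ toℕ (V.lookup x i) - + toℕ z) Q ≡ true) xᵢ≡xⱼ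
                                           (isZeroMod-diff-self (V.lookup x i)))

  ColumnsNonzero⇒All : ∀ x → ColumnsNonzero x → All (NonzeroEntry x) (A m t t≤m s)
  ColumnsNonzero⇒All x (scaled-nonzero , distinct) =
    AP.++⁺ (AP.map⁺ (AP.tabulate⁺ (λ i → subst (λ z → isZeroMod z Q ≡ false)
                                               (sym (dot-scaledUnit x (inject≤ i t≤m) (s i))) (scaled-nonzero i))))
           (AP.concat⁺ (AP.map⁺ (AP.tabulate⁺ (λ i → AP.concat⁺ (AP.map⁺ (AP.tabulate⁺ (λ j →
             diff-nonzero i j (toℕ i <? toℕ j))))))))
    where
    diff-nonzero : ∀ i j (i<j? : Dec (toℕ i < toℕ j)) →
      All (NonzeroEntry x) (columnIf (does i<j?) (diffColumn i j))
    diff-nonzero i j (no  _)   = []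
    diff-nonzero i j (yes i<j) with isZeroMod (+ toℕ (V.lookup x i) - + toℕ (V.lookup x j)) Q in xᵢ-xⱼ≡0?
    ... | true  = ⊥-elim (distinct i j i<j (isZeroMod-diff⇒≡ (V.lookup x i) (V.lookup x j) xᵢ-xⱼ≡0?))
    ... | false = subst (λ z → isZeroMod z Q ≡ false) (sym (dot-unitDiff x i j)) xᵢ-xⱼ≡0? ∷ []

  ColumnsNonzero⇔Admissible : ∀ x → ColumnsNonzero x ⇔ Admissible 0 [] x
  ColumnsNonzero⇔Admissible x = mk⇔
    (λ (scaled-nonzero , distinct) → avoids scaled-nonzero , distinct , (λ _ → refl))
    (λ (avoids , distinct , _) → scaled-nonzero avoids , distinct)
    where
    avoids : (∀ i → torsion Q (s i) (V.lookup x (inject≤ i t≤m)) ≡ false) →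
             ∀ j → forbidden (toℕ j) (V.lookup x j) ≡ false
    avoids scaled-nonzero j = by-cases (toℕ j <? t)
      where
      by-cases : Dec (toℕ j < t) → forbidden (toℕ j) (V.lookup x j) ≡ false
      by-cases (no  j≮t) = extend-≮ (λ i → torsion Q (s i) (V.lookup x j)) false (toℕ j) j≮t
      by-cases (yes j<t) = trans (extend-< (λ i → torsion Q (s i) (V.lookup x j)) false (toℕ j) j<t)
                                 (subst (λ z → torsion Q (s (fromℕ< j<t)) (V.lookup x z) ≡ false) inject≤-fromℕ<
                                        (scaled-nonzero (fromℕ< j<t)))
        where
        inject≤-fromℕ< : inject≤ (fromℕ< j<t) t≤m ≡ j
        inject≤-fromℕ< = FP.toℕ-injective (trans (FP.toℕ-inject≤ _ t≤m) (FP.toℕ-fromℕ< j<t))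
    scaled-nonzero : (∀ j → forbidden (toℕ j) (V.lookup x j) ≡ false) →
                     ∀ i → torsion Q (s i) (V.lookup x (inject≤ i t≤m)) ≡ false
    scaled-nonzero avoids i = subst (λ z → torsion Q (s z) xᵢ ≡ false) fromℕ<-toℕ
      (trans (sym (extend-< (λ i′ → torsion Q (s i′) xᵢ) false _ i<t)) (avoids (inject≤ i t≤m)))
      where
      xᵢ : Fin Q
      xᵢ = V.lookup x (inject≤ i t≤m)
      i<t : toℕ (inject≤ i t≤m) < t
      i<t = subst (_< t) (sym (FP.toℕ-inject≤ i t≤m)) (FP.toℕ<n i)
      fromℕ<-toℕ : fromℕ< i<t ≡ i
      fromℕ<-toℕ = FP.toℕ-injective (trans (FP.toℕ-fromℕ< i<t) (FP.toℕ-inject≤ i t≤m))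

  allNonzero≡admissibleᵇ : ∀ x → allNonzero (A m t t≤m s) x ≡ admissibleᵇ 0 [] x
  allNonzero≡admissibleᵇ x = ⇔→≡ (mk⇔
    (λ h → Admissible⇒admissibleᵇ 0 [] x (Equivalence.to (ColumnsNonzero⇔Admissible x)
             (All⇒ColumnsNonzero x (Equivalence.to (allNonzero⇔All (A m t t≤m s) x) h))))
    (λ h → Equivalence.from (allNonzero⇔All (A m t t≤m s) x) (ColumnsNonzero⇒All x
             (Equivalence.from (ColumnsNonzero⇔Admissible x) (admissibleᵇ⇒Admissible 0 [] x h)))))

  χquasi-A≡prodFrom : + χquasi (A m t t≤m s) Q ≡ prodFrom 0 m
  χquasi-A≡prodFrom = trans
    (cong +_ (trans (length-filter≡countList (allNonzero (A m t t≤m s)) (allVecs m Q))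
                    (countList-cong allNonzero≡admissibleᵇ (allVecs m Q))))
    (countList-admissibleᵇ m 0 [] ((λ _ ()) , countFin-false Q))

  prodD≡prodFrom : prodD Q k t s ≡ prodFrom 0 t
  prodD≡prodFrom = begin
      foldr-* (L.map f (L.allFin t))                    ≡⟨ cong foldr-* (LP.map-tabulate (λ j → j) f) ⟩
      foldr-* (L.tabulate f)                            ≡⟨ cong foldr-* (LP.tabulate-cong {n = t} f≗factor) ⟩
      foldr-* (L.tabulate {n = t} (λ j → factor (toℕ j))) ≡⟨ cong foldr-* (tabulate-toℕ t factor) ⟩
      foldr-* (L.applyUpTo factor t)                    ≡⟨ sym (prodFrom≡foldr-* 0 t) ⟩
      prodFrom 0 t                                      ∎
    where
    open ≡-Reasoning
    f : Fin t → ℤ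
    f j = + Q - + gcd k (s j) - + toℕ j
    f≗factor : ∀ j → f j ≡ factor (toℕ j)
    f≗factor j = cong (λ z → + Q - + z - + toℕ j)
      (sym (trans (extend-< (λ i → gcd k (s i)) 0 (toℕ j) (FP.toℕ<n j)) (cong (λ i → gcd k (s i)) (FP.fromℕ<-toℕ j _))))

  prodRest≡prodFrom : ∀ r → m ≡ t + r → prodRest Q t m ≡ prodFrom t r
  prodRest≡prodFrom r m≡t+r = begin
      foldr-* (L.map g (L.filter (t ≤?_) (L.upTo m)))
        ≡⟨ cong (λ z → foldr-* (L.map g (L.filter (t ≤?_) z))) (trans (cong L.upTo m≡t+r) (applyUpTo-+ (λ i → i) t r)) ⟩
      foldr-* (L.map g (L.filter (t ≤?_) (L.upTo t ++ L.applyUpTo (N._+_ t) r)))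
        ≡⟨ cong (λ z → foldr-* (L.map g z)) (LP.filter-++ (t ≤?_) (L.upTo t) (L.applyUpTo (N._+_ t) r)) ⟩
      foldr-* (L.map g (L.filter (t ≤?_) (L.upTo t) ++ L.filter (t ≤?_) (L.applyUpTo (N._+_ t) r)))
        ≡⟨ cong₂ (λ u v → foldr-* (L.map g (u ++ v)))
             (LP.filter-none (t ≤?_) (AP.applyUpTo⁺₁ (λ i → i) t NP.<⇒≱))
             (LP.filter-all (t ≤?_) (AP.applyUpTo⁺₂ (N._+_ t) r (NP.m≤m+n t))) ⟩
      foldr-* (L.map g (L.applyUpTo (N._+_ t) r))          ≡⟨ cong foldr-* (LP.map-applyUpTo (N._+_ t) g r) ⟩
      foldr-* (L.applyUpTo (λ i → g (t + i)) r)         ≡⟨ cong foldr-* (applyUpTo-cong r g≗factor) ⟩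
      foldr-* (L.applyUpTo (λ i → factor (t + i)) r)    ≡⟨ sym (prodFrom≡foldr-* t r) ⟩
      prodFrom t r                                      ∎
    where
    open ≡-Reasoning
    g : ℕ → ℤ
    g j = + Q - + j
    g≗factor : ∀ i → g (t + i) ≡ factor (t + i)
    g≗factor i = cong (_- + (t + i)) (trans (sym (ZP.+-identityʳ (+ Q)))
      (cong (λ z → + Q - + z) (sym (extend-≮ (λ i′ → gcd k (s i′)) 0 (t + i) (NP.≤⇒≯ (NP.m≤m+n t i))))))

  χquasi-A≡prodD*prodRest : + χquasi (A m t t≤m s) Q ≡ prodD Q k t s ℤ.* prodRest Q t m
  χquasi-A≡prodD*prodRest = begin
    + χquasi (A m t t≤m s) Q                  ≡⟨ χquasi-A≡prodFrom ⟩
    prodFrom 0 m                              ≡⟨ cong (prodFrom 0) m≡t+r ⟩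
    prodFrom 0 (t + r)                        ≡⟨ prodFrom-+ 0 t r ⟩
    prodFrom 0 t ℤ.* prodFrom t r             ≡⟨ sym (cong₂ ℤ._*_ prodD≡prodFrom (prodRest≡prodFrom r m≡t+r)) ⟩
    prodD Q k t s ℤ.* prodRest Q t m          ∎
    where
    open ≡-Reasoning
    r : ℕ
    r = m ∸ t
    m≡t+r : m ≡ t + r
    m≡t+r = sym (NP.m+[n∸m]≡n t≤m)

s∣ρ : ∀ t (s : Fin t → ℕ) → (∀ (i j : Fin t) → i Fin.≤ j → s j ∣ s i) → ∀ i → s i ∣ ρ t s
s∣ρ (suc t) s s-∣ i = s-∣ zero i z≤n

theorem3p2 : (m t : ℕ) → 1 ≤ m → (t≤m : t ≤ m) → (s : Fin t → ℕ)
    → (∀ i → 1 ≤ s i)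
    → (∀ (i j : Fin t) → i Fin.≤ j → s j ∣ s i)
    → (k : ℕ) → 1 ≤ k → k ∣ ρ t s
    → (n : ℕ) → (q : ℕ) → q ≡ k + ρ t s * n
    → + χquasi (A m t t≤m s) q ≡ prodD q k t s ℤ.* prodRest q t m
theorem3p2 m t _ t≤m s _ s-∣ zero () _ n q _
theorem3p2 m t _ t≤m s _ s-∣ (suc k′) _ _ n .(suc k′ + ρ t s * n) refl =
  ColumnCount.χquasi-A≡prodD*prodRest m t t≤m s s-∣ (suc k′) (k′ + ρ t s * n)
    (λ i → gcd-+-multiple (suc k′) (s i) (ρ t s) n (s∣ρ t s s-∣ i))
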